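{- Let $G$ be a graph, let $(T,\{X_i:i\in V(T)\})$ be a tree decomposition of $G$ of width $k$ with $T$ rooted, and let $\theta$, $\sigma$ be as in the context. For $i\in\{0,\dots,k\}$ let $C_i=\{v\in V(G):\theta(v)=i\}$, $G_i^1=\tau(G,C_i,\sigma|_{C_i})$ and $G_i^2=\tau(G,C_i,\sigma^{ -1}|_{C_i})$. Then $G=\bigcap_{0\le i\le k}(G_i^1\cap G_i^2)$.
   Context: A tree decomposition of $G$ is a pair $(T,\{X_i\})$ with $T$ a tree and $X_i\subseteq V(G)$ such that $\bigcup_iX_i=V(G)$, each edge has both ends in some $X_i$, and $X_i\cap X_k\subseteq X_j$ whenever $j$ is on the $T$-path from $i$ to $k$; width is $\max_i|X_i|-1$. In the rooted tree $T$, ancestors of a node are the nodes on its path to the root (including itself). For $v\in V(G)$, $b(v)$ is the node of $T$ with $v\in X_{b(v)}$ and $v\notin X_i$ for every proper ancestor $i$ of $b(v)$. $\theta\colon V(G)\to\{0,\dots,k\}$ is any function such that distinct vertices in a common bag $X_i$ get distinct values (in particular each $C_i$ is independent in $G$). $\pi$ is a preorder (depth-first) traversal of $T$ from the root, and $\sigma$ is an ordering of $V(G)$ with $u$ before $v$ whenever $b(u)$ precedes $b(v)$ in $\pi$ (ties arbitrary); $\sigma^{ -1}$ is the reverse of $\sigma$, and $\sigma|_A$ is the restriction of $\sigma$ to $A$. For an independent set $A=\{u_1,\dots,u_t\}$ with ordering $u_1,\dots,u_t$, let $B=V(G)\setminus A$, $s(v)=\max\{j:u_j\in N_G(v)\}$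 for $v\in B$ with $N_G(v)\cap A\neq\emptyset$ and $s(v)=0$ otherwise; $\tau(G,A,\cdot)$ is the graph on $V(G)$ with edge set $E(G)\cup\{xy:x,y\in B, x\ne y\}\cup\bigcup_{v\in B}\{vu_1,\dots,vu_{s(v)}\}$. For graphs on the same vertex set, $\cap$ means intersection of edge sets. -}

module Defs where

open import Level using (0ℓ)
open import Data.Nat using (ℕ; suc)
open import Data.Fin using (Fin; _≟_)
open import Data.Fin.Subset using (Subset; _∈_; _∉_; ∣_∣)
open import Data.List using (List; []; _∷_; _++_; [_]; concat; filter; reverse)
import Data.List.Membership.Propositional as LM
open import Data.List.Relation.Unary.Unique.Propositional using (Unique)
open import Data.List.Relation.Binary.Pointwise using (Pointwise)
open import Data.Product using (Σ; ∃; ∃-syntax; _×_)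
open import Data.Sum using (_⊎_)
open import Relation.Binary.PropositionalEquality using (_≡_; _≢_)
open import Relation.Nullary using (¬_)

record Graph (n : ℕ) : Set₁ where
  field
    E       : Fin n → Fin n → Set
    E-sym   : ∀ {x y} → E x y → E y x
    E-irrefl : ∀ {x} → ¬ E x x
open Graph public

-- The root is its own parent; every node reaches the root by following
-- parents (hence there are no cycles); the tree edges are {a, par a}.

module _ {m : ℕ} (par : Fin m → Fin m) where
  data Anc (i : Fin m) : Fin m → Set where
    anc-refl : Anc i i
    anc-step : ∀ {j} → Anc (par i) j → Anc i j

record RootedTree (m : ℕ) : Set where
  field
    par       : Fin m → Fin m
    root      : Fin m
    par-root  : par root ≡ root
    fixed⇒root : ∀ i → par i ≡ i → i ≡ root
    reach-root : ∀ i → Anc par i root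
open RootedTree public

module _ {m : ℕ} (T : RootedTree m) where
  TAdj : Fin m → Fin m → Set
  TAdj a b = (par T a ≡ b × a ≢ b) ⊎ (par T b ≡ a × a ≢ b)

  data Walk : Fin m → Fin m → List (Fin m) → Set where
    w-nil  : ∀ {i} → Walk i i [ i ]
    w-cons : ∀ {i j k p} → TAdj i j → Walk j k p → Walk i k (i ∷ p)

  TPath : Fin m → Fin m → List (Fin m) → Set
  TPath i k p = Walk i k p × Unique p

  ProperAnc : Fin m → Fin m → Set
  ProperAnc i j = Anc (par T) i j × j ≢ i

  Child : Fin m → Fin m → Set
  Child c v = par T c ≡ v × c ≢ v

  -- Pre v l : l is a preorder (depth-first) traversal of the subtree
  -- rooted at v: first v, then preorder traversals of the subtrees of
  -- the children of v, the children taken in some order.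
  data Pre (v : Fin m) : List (Fin m) → Set where
    pre : (cs : List (Fin m)) → Unique cs →
          (∀ c → c LM.∈ cs → Child c v) → (∀ c → Child c v → c LM.∈ cs) →
          (ls : List (List (Fin m))) → Pointwise Pre cs ls →
          Pre v (v ∷ concat ls)

  Preorder : List (Fin m) → Set
  Preorder π = Pre (root T) π

Before : {A : Set} → List A → A → A → Set
Before l a b = ∃[ xs ] ∃[ ys ] ∃[ zs ] (l ≡ xs ++ (a ∷ ys) ++ (b ∷ zs))

record TreeDecomp {n m : ℕ} (G : Graph n) (T : RootedTree m) (k : ℕ) : Set where
  field
    X        : Fin m → Subset n
    cover    : ∀ v → ∃[ i ] (v ∈ X i)
    edge     : ∀ {u v} → E G u v → ∃[ i ] (u ∈ X i × v ∈ X i)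
    coherent : ∀ i j k′ p → TPath T i k′ p → j LM.∈ p →
               ∀ v → v ∈ X i → v ∈ X k′ → v ∈ X j
    -- width exactly k : max |X_i| - 1 = k
    width-≤  : ∀ i → ∣ X i ∣ Data.Nat.≤ suc k
    width-=  : ∃[ i ] (∣ X i ∣ ≡ suc k)
open TreeDecomp public

-- τ(G, A, ord), where A is the set of entries of the list ord and ord
-- lists A in the order u₁,…,u_t.  The edge relation is symmetric.

module _ {n : ℕ} (G : Graph n) (ord : List (Fin n)) where
  -- y = u_j with j ≤ s(x): some neighbour u_l of x in A has l ≥ j
  -- (i.e. y occurs in ord at or before a neighbour of x)
  Tail : Fin n → Fin n → Set
  Tail x y = x LM.∉ ord × ∃[ xs ] ∃[ ys ] (ord ≡ xs ++ (y ∷ ys) × ∃[ w ] (w LM.∈ (y ∷ ys) × E G x w))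

  τE : Fin n → Fin n → Set
  τE x y = E G x y
         ⊎ (x LM.∉ ord × y LM.∉ ord × x ≢ y)
         ⊎ Tail x y
         ⊎ Tail y x

{-# OPTIONS --safe #-}
-- Every τ-graph contains G, so only the reverse inclusion needs work.  If x y is an
-- edge of every G_i^1 and G_i^2 but not of G, then, taking i = θ(x), y has neighbours
-- w⁻ and w⁺ of the colour of x before and after x in σ; symmetrically x has
-- neighbours z⁻, z⁺ of the colour of y around y.  Say b(x) comes no later than b(y)
-- in π.  If b(y) lies below b(x), so does a bag holding y and w⁻; as w⁻ ≠ x have one
-- colour, w⁻ ∉ X_{b(x)}, which forces b(w⁻) strictly below b(x) and hence x before w⁻
-- in σ.  Otherwise look at a bag holding x and z⁺: either b(z⁺) is an ancestor of b(x),
-- so z⁺ comes before y, or b(z⁺) lies below b(x); then b(z⁺) ≠ b(y) by the colouring,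
-- b(z⁺) cannot precede b(y), and b(y) cannot precede b(z⁺) because subtrees are
-- contiguous in a preorder and b(y) is not below b(x).
module Submission where

open import Defs
open import Data.Nat using (ℕ; suc)
open import Data.Fin using (Fin; _≟_)
open import Data.Fin.Subset using (_∈_; _∉_)
open import Data.List using (List; []; _∷_; _++_; [_]; concat; filter; reverse)
open import Data.List.Properties using (++-assoc; ++-identityʳ; reverse-++; reverse-involutive)
open import Data.List.Membership.Propositional using () renaming (_∈_ to _∈ₗ_)
open import Data.List.Membership.Propositional.Properties
  using (∈-∃++; ∈-++⁻; ∈-++⁺ˡ; ∈-++⁺ʳ; ∈-filter⁺; ∈-filter⁻)
open import Data.List.Relation.Unary.Any using (here; there)
open import Data.List.Relation.Unary.Any.Properties using (reverse⁺)
open import Data.List.Relation.Unary.All as All using ([])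
open import Data.List.Relation.Unary.All.Properties.Core using (All¬⇒¬Any; ¬Any⇒All¬)
open import Data.List.Relation.Unary.Unique.Propositional using (Unique)
open import Data.List.Relation.Unary.Unique.Propositional.Properties using (++⁺)
open import Data.List.Relation.Binary.Pointwise using (Pointwise; []; _∷_)
open import Data.List.Relation.Unary.AllPairs using ([]; _∷_)
open import Data.Bool using (true; false)
open import Data.Product using (∃-syntax; _×_; _,_; proj₁; proj₂; map; map₁)
open import Data.Sum using (_⊎_; inj₁; inj₂)
open import Data.Empty using (⊥; ⊥-elim)
open import Function.Bundles using (_⇔_; mk⇔)
open import Relation.Nullary using (¬_; Dec; yes; no; does)
open import Relation.Unary using (Decidable)
open import Relation.Binary.PropositionalEquality
  using (_≡_; _≢_; refl; sym; trans; cong; subst; module ≡-Reasoning)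

module _ {A : Set} where

  Before-∷⁻ : ∀ {h t} {a b : A} → Before (h ∷ t) a b → (a ≡ h × b ∈ₗ t) ⊎ Before t a b
  Before-∷⁻ ([] , ys , zs , refl) = inj₁ (refl , ∈-++⁺ʳ ys (here refl))
  Before-∷⁻ (_ ∷ xs , ys , zs , refl) = inj₂ (xs , ys , zs , refl)

  Before-head : ∀ {a b : A} {t} → b ∈ₗ t → Before (a ∷ t) a b
  Before-head b∈t with ∈-∃++ b∈t
  ... | ys , zs , refl = [] , ys , zs , refl

  Before-++ˡ : ∀ (xs : List A) {l a b} → Before l a b → Before (xs ++ l) a b
  Before-++ˡ xs (ps , ys , zs , refl) = xs ++ ps , ys , zs , sym (++-assoc xs ps _)

  Before-++ʳ : ∀ (S : List A) {l a b} → Before l a b → Before (l ++ S) a b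
  Before-++ʳ S {a = a} {b} (xs , ys , zs , refl) = xs , ys , zs ++ S , (begin
    (xs ++ (a ∷ ys) ++ (b ∷ zs)) ++ S  ≡⟨ ++-assoc xs _ S ⟩
    xs ++ ((a ∷ ys) ++ (b ∷ zs)) ++ S  ≡⟨ cong (xs ++_) (++-assoc (a ∷ ys) _ S) ⟩
    xs ++ (a ∷ ys) ++ (b ∷ zs ++ S)    ∎)
    where open ≡-Reasoning

  Before-∈ˡ : ∀ {a b : A} {l} → Before l a b → a ∈ₗ l
  Before-∈ˡ (xs , ys , zs , refl) = ∈-++⁺ʳ xs (here refl)

  Before-∈ʳ : ∀ {a b : A} {l} → Before l a b → b ∈ₗ l
  Before-∈ʳ (xs , ys , zs , refl) = ∈-++⁺ʳ xs (there (∈-++⁺ʳ ys (here refl)))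

  Before-++⁺ : ∀ (P : List A) {S a b} → a ∈ₗ P → b ∈ₗ S → Before (P ++ S) a b
  Before-++⁺ P a∈P b∈S with ∈-∃++ a∈P | ∈-∃++ b∈S
  ... | xs , ys , refl | us , vs , refl = xs , ys ++ us , vs ,
    trans (++-assoc xs _ _) (cong (λ r → xs ++ _ ∷ r) (sym (++-assoc ys us _)))

  Before-[] : ∀ {a b : A} → ¬ Before [] a b
  Before-[] p with Before-∈ˡ p
  ... | ()

  Before-irrefl : ∀ {l} {a : A} → Unique l → ¬ Before l a a
  Before-irrefl {[]} _ p = Before-[] p
  Before-irrefl (a∉t ∷ u) p with Before-∷⁻ p
  ... | inj₁ (refl , a∈t) = All¬⇒¬Any a∉t a∈t
  ... | inj₂ p′ = Before-irrefl u p′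

  Before-trans : ∀ {l} {a b c : A} → Unique l → Before l a b → Before l b c → Before l a c
  Before-trans {[]} _ p _ = ⊥-elim (Before-[] p)
  Before-trans {h ∷ t} (h∉t ∷ u) p q with Before-∷⁻ p | Before-∷⁻ q
  ... | inj₁ (refl , b∈t) | inj₁ (refl , _) = ⊥-elim (All¬⇒¬Any h∉t b∈t)
  ... | inj₂ p′ | inj₁ (refl , _) = ⊥-elim (All¬⇒¬Any h∉t (Before-∈ʳ p′))
  ... | inj₁ (refl , _) | inj₂ q′ = Before-head (Before-∈ʳ q′)
  ... | inj₂ p′ | inj₂ q′ = Before-++ˡ [ h ] (Before-trans u p′ q′)

  Before-asym : ∀ {l} {a b : A} → Unique l → Before l a b → ¬ Before l b a
  Before-asym u p q = Before-irrefl u (Before-trans u p q)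

  Before-total : ∀ {l} {a b : A} → a ∈ₗ l → b ∈ₗ l → a ≢ b → Before l a b ⊎ Before l b a
  Before-total (here refl) (here refl) a≢b = ⊥-elim (a≢b refl)
  Before-total (here refl) (there b∈t) _ = inj₁ (Before-head b∈t)
  Before-total (there a∈t) (here refl) _ = inj₂ (Before-head a∈t)
  Before-total (there a∈t) (there b∈t) a≢b with Before-total a∈t b∈t a≢b
  ... | inj₁ p = inj₁ (Before-++ˡ [ _ ] p)
  ... | inj₂ p = inj₂ (Before-++ˡ [ _ ] p)

  Before-reverse⁻ : ∀ {l} {a b : A} → Before (reverse l) a b → Before l b a
  Before-reverse⁻ {l} {a} {b} (xs , ys , zs , eq) = subst (λ r → Before r b a) l≡
    (Before-++⁺ (reverse (ys ++ b ∷ zs)) (reverse⁺ (∈-++⁺ʳ ys (here refl)))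
                                         (reverse⁺ (∈-++⁺ʳ xs (here refl))))
    where
    open ≡-Reasoning
    l≡ : reverse (ys ++ b ∷ zs) ++ reverse (xs ++ [ a ]) ≡ l
    l≡ = begin
      reverse (ys ++ b ∷ zs) ++ reverse (xs ++ [ a ])  ≡⟨ reverse-++ (xs ++ [ a ]) _ ⟨
      reverse ((xs ++ [ a ]) ++ ys ++ b ∷ zs)         ≡⟨ cong reverse (++-assoc xs _ _) ⟩
      reverse (xs ++ a ∷ ys ++ b ∷ zs)                ≡⟨ cong reverse eq ⟨
      reverse (reverse l)                             ≡⟨ reverse-involutive l ⟩
      l                                               ∎

  Before-filter⁻ : ∀ {p} {P : A → Set p} (P? : Decidable P) {l a b} →
                   Before (filter P? l) a b → Before l a b
  Before-filter⁻ P? {[]} q = ⊥-elim (Before-[] q)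
  Before-filter⁻ P? {h ∷ t} q with does (P? h)
  ... | false = Before-++ˡ [ h ] (Before-filter⁻ P? q)
  ... | true with Before-∷⁻ q
  ...   | inj₁ (refl , b∈t) = Before-head (proj₁ (∈-filter⁻ P? b∈t))
  ...   | inj₂ q′ = Before-++ˡ [ h ] (Before-filter⁻ P? q′)

  Before-segment : ∀ (P M S : List A) {u q r} → Unique (P ++ M ++ S) → u ∈ₗ M → q ∈ₗ M →
                   Before (P ++ M ++ S) u r → Before (P ++ M ++ S) r q → r ∈ₗ M
  Before-segment P M S {u} {q} {r} uniq u∈M q∈M u<r r<q with ∈-++⁻ P (Before-∈ʳ u<r)
  ... | inj₁ r∈P = ⊥-elim (Before-asym uniq u<r (Before-++⁺ P r∈P (∈-++⁺ˡ u∈M)))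
  ... | inj₂ r∈MS with ∈-++⁻ M r∈MS
  ...   | inj₁ r∈M = r∈M
  ...   | inj₂ r∈S = ⊥-elim (Before-asym uniq r<q
          (subst (λ l → Before l q r) (++-assoc P M S) (Before-++⁺ (P ++ M) (∈-++⁺ʳ P q∈M) r∈S)))

module Ancestry {m : ℕ} (T : RootedTree m) where

  open import Data.List.Membership.DecPropositional (_≟_ {m}) using (_∈?_)

  infix 4 _⊑_ _⊑?_
  _⊑_ : Fin m → Fin m → Set
  _⊑_ = Anc (par T)

  ⊑-trans : ∀ {i j k} → i ⊑ j → j ⊑ k → i ⊑ k
  ⊑-trans anc-refl q = q
  ⊑-trans (anc-step p) q = anc-step (⊑-trans p q)

  ⊑-par : ∀ {i} → i ⊑ par T i
  ⊑-par = anc-step anc-refl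

  ⊑-comparable : ∀ {i a b} → i ⊑ a → i ⊑ b → a ⊑ b ⊎ b ⊑ a
  ⊑-comparable anc-refl q = inj₁ q
  ⊑-comparable (anc-step p) anc-refl = inj₂ (anc-step p)
  ⊑-comparable (anc-step p) (anc-step q) = ⊑-comparable p q

  par-≡-root : ∀ {i} → i ≡ root T → par T i ≡ root T
  par-≡-root refl = par-root T

  root-⊑ : ∀ {i j} → i ≡ root T → i ⊑ j → j ≡ root T
  root-⊑ i≡r anc-refl = i≡r
  root-⊑ i≡r (anc-step h) = root-⊑ (par-≡-root i≡r) h

  cycle⇒root : ∀ {j} → par T j ⊑ j → j ≡ root T
  cycle⇒root {j} cyc = root-⊑ refl (above-below-j (reach-root T j) anc-refl)
    where
    -- With the cycle, every ancestor of a node below j is below j, the root included.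
    above-below-j : ∀ {x i} → x ⊑ i → x ⊑ j → i ⊑ j
    above-below-j anc-refl x⊑j = x⊑j
    above-below-j (anc-step x⊑i) anc-refl = above-below-j x⊑i cyc
    above-below-j (anc-step x⊑i) (anc-step x⊑j) = above-below-j x⊑i x⊑j

  ⊑-antisym : ∀ {i j} → i ⊑ j → j ⊑ i → i ≡ j
  ⊑-antisym anc-refl _ = refl
  ⊑-antisym {i} (anc-step pi⊑j) j⊑i = trans i≡r (sym (root-⊑ (par-≡-root i≡r) pi⊑j))
    where
    i≡r : i ≡ root T
    i≡r = cycle⇒root (⊑-trans pi⊑j j⊑i)

  _⊑?_ : ∀ i j → Dec (i ⊑ j)
  i ⊑? j = decide (reach-root T i)
    where
    decide : ∀ {i} → i ⊑ root T → Dec (i ⊑ j)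
    decide {i} i⊑r with i ≟ j
    ... | yes refl = yes anc-refl
    decide anc-refl | no r≢j = no (λ r⊑j → r≢j (sym (root-⊑ refl r⊑j)))
    decide (anc-step i⊑r) | no i≢j with decide i⊑r
    ... | yes pi⊑j = yes (anc-step pi⊑j)
    ... | no pi⋢j = no λ { anc-refl → i≢j refl ; (anc-step pi⊑j) → pi⋢j pi⊑j }

  TAdj-sym : ∀ {a b} → TAdj T a b → TAdj T b a
  TAdj-sym (inj₁ (e , a≢b)) = inj₂ (e , λ b≡a → a≢b (sym b≡a))
  TAdj-sym (inj₂ (e , a≢b)) = inj₁ (e , λ b≡a → a≢b (sym b≡a))

  Walk-head : ∀ {i k p} → Walk T i k p → i ∈ₗ p
  Walk-head w-nil = here refl
  Walk-head (w-cons _ _) = here refl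

  Walk-++ : ∀ {i j k p q} → Walk T i j p → Walk T j k q → ∃[ r ] Walk T i k r
  Walk-++ w-nil w = _ , w
  Walk-++ (w-cons a w) w′ = _ , w-cons a (proj₂ (Walk-++ w w′))

  Walk-reverse : ∀ {i k p} → Walk T i k p → ∃[ r ] Walk T k i r
  Walk-reverse w-nil = _ , w-nil
  Walk-reverse (w-cons a w) = Walk-++ (proj₂ (Walk-reverse w)) (w-cons (TAdj-sym a) w-nil)

  ⊑⇒Walk : ∀ {i j} → i ⊑ j → ∃[ r ] Walk T i j r
  ⊑⇒Walk anc-refl = _ , w-nil
  ⊑⇒Walk {i} (anc-step h) with par T i ≟ i
  -- the root's self-loop is not a tree edge
  ... | yes pi≡i = subst (λ x → ∃[ r ] Walk T x _ r) pi≡i (⊑⇒Walk h)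
  ... | no pi≢i = _ , w-cons (inj₁ (refl , λ i≡pi → pi≢i (sym i≡pi))) (proj₂ (⊑⇒Walk h))

  Walk-via-root : ∀ i j → ∃[ r ] Walk T i j r
  Walk-via-root i j = Walk-++ (proj₂ (⊑⇒Walk (reach-root T i)))
                              (proj₂ (Walk-reverse (proj₂ (⊑⇒Walk (reach-root T j)))))

  Walk-suffix : ∀ {i k x rest} (ps : List (Fin m)) → Walk T i k (ps ++ x ∷ rest) → Walk T x k (x ∷ rest)
  Walk-suffix [] w-nil = w-nil
  Walk-suffix [] (w-cons a w) = w-cons a w
  Walk-suffix (_ ∷ []) (w-cons _ w) = Walk-suffix [] w
  Walk-suffix (_ ∷ p ∷ ps) (w-cons _ w) = Walk-suffix (p ∷ ps) w

  Unique-suffix : ∀ {x rest} (ps : List (Fin m)) → Unique (ps ++ x ∷ rest) → Unique (x ∷ rest)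
  Unique-suffix [] u = u
  Unique-suffix (_ ∷ ps) (_ ∷ u) = Unique-suffix ps u

  Walk⇒TPath : ∀ {i k p} → Walk T i k p → ∃[ q ] TPath T i k q
  Walk⇒TPath w-nil = _ , w-nil , [] ∷ []
  Walk⇒TPath {i} (w-cons a w) with Walk⇒TPath w
  ... | q , wq , uq with i ∈? q
  ...   | no i∉q = _ , w-cons a wq , ¬Any⇒All¬ q i∉q ∷ uq
  ...   | yes i∈q with ∈-∃++ i∈q
  ...     | ps , rest , refl = _ , Walk-suffix ps wq , Unique-suffix ps uq

  Walk-leaves-subtree : ∀ {i k p j} → Walk T i k p → i ⊑ j → ¬ k ⊑ j →
                        j ∈ₗ p × par T j ∈ₗ p × par T j ≢ j
  Walk-leaves-subtree w-nil i⊑j k⋢j = ⊥-elim (k⋢j i⊑j)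
  Walk-leaves-subtree (w-cons (inj₁ (refl , i≢pi)) w) anc-refl _ =
    here refl , there (Walk-head w) , λ pi≡i → i≢pi (sym pi≡i)
  Walk-leaves-subtree (w-cons (inj₁ (refl , _)) w) (anc-step pi⊑j) k⋢j =
    map there (map₁ there) (Walk-leaves-subtree w pi⊑j k⋢j)
  Walk-leaves-subtree (w-cons (inj₂ (refl , _)) w) i⊑j k⋢j =
    map there (map₁ there) (Walk-leaves-subtree w (anc-step i⊑j) k⋢j)

  Child⇒⊑ : ∀ {c v} → Child T c v → c ⊑ v
  Child⇒⊑ (refl , _) = ⊑-par

  ⊑-via-child : ∀ {x v} → x ⊑ v → x ≢ v → ∃[ c ] Child T c v × x ⊑ c
  ⊑-via-child anc-refl x≢v = ⊥-elim (x≢v refl)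
  ⊑-via-child {x} {v} (anc-step px⊑v) x≢v with par T x ≟ v
  ... | yes px≡v = x , (px≡v , x≢v) , anc-refl
  ... | no px≢v with ⊑-via-child px⊑v px≢v
  ...   | c , c-child , px⊑c = c , c-child , anc-step px⊑c

  sibling-⋢ : ∀ {c c′ v} → Child T c v → Child T c′ v → c ≢ c′ → ¬ c ⊑ c′
  sibling-⋢ _ _ c≢c′ anc-refl = c≢c′ refl
  sibling-⋢ (refl , _) c′-child@(_ , c′≢v) _ (anc-step v⊑c′) =
    c′≢v (⊑-antisym (Child⇒⊑ c′-child) v⊑c′)

  siblings-disjoint : ∀ {c c′ v x} → Child T c v → Child T c′ v → c ≢ c′ → x ⊑ c → ¬ x ⊑ c′
  siblings-disjoint ch ch′ c≢c′ x⊑c x⊑c′ with ⊑-comparable x⊑c x⊑c′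
  ... | inj₁ c⊑c′ = sibling-⋢ ch ch′ c≢c′ c⊑c′
  ... | inj₂ c′⊑c = sibling-⋢ ch′ ch (λ c′≡c → c≢c′ (sym c′≡c)) c′⊑c

  mutual
    Pre-⊑ : ∀ {v l x} → Pre T v l → x ∈ₗ l → x ⊑ v
    Pre-⊑ (pre _ _ _ _ _ _) (here refl) = anc-refl
    Pre-⊑ (pre _ _ children _ _ pres) (there x∈) with Pres-⊑ pres x∈
    ... | c , c∈ , x⊑c = ⊑-trans x⊑c (Child⇒⊑ (children c c∈))

    Pres-⊑ : ∀ {cs ls x} → Pointwise (Pre T) cs ls → x ∈ₗ concat ls → ∃[ c ] c ∈ₗ cs × x ⊑ c
    Pres-⊑ (p ∷ ps) x∈ with ∈-++⁻ _ x∈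
    ... | inj₁ x∈l = _ , here refl , Pre-⊑ p x∈l
    ... | inj₂ x∈ls with Pres-⊑ ps x∈ls
    ...   | c , c∈ , x⊑c = c , there c∈ , x⊑c

  mutual
    Pre-subtree : ∀ {v l u} → Pre T v l → u ⊑ v →
                  ∃[ ps ] ∃[ ss ] ∃[ L ] l ≡ ps ++ L ++ ss × Pre T u L
    Pre-subtree {v} {u = u} pv@(pre _ _ _ allChildren _ pres) u⊑v with u ≟ v
    ... | yes refl = [] , [] , _ , sym (++-identityʳ _) , pv
    ... | no u≢v with ⊑-via-child u⊑v u≢v
    ...   | c , c-child , u⊑c with Pres-subtree pres (allChildren c c-child) u⊑c
    ...     | ps , ss , L , eq , pu = v ∷ ps , ss , L , cong (v ∷_) eq , pu

    Pres-subtree : ∀ {cs ls c u} → Pointwise (Pre T) cs ls → c ∈ₗ cs → u ⊑ c →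
                   ∃[ ps ] ∃[ ss ] ∃[ L ] concat ls ≡ ps ++ L ++ ss × Pre T u L
    Pres-subtree {ls = l ∷ ls} (p ∷ _) (here refl) u⊑c with Pre-subtree p u⊑c
    ... | ps , ss , L , refl , pu = ps , ss ++ concat ls , L ,
      trans (++-assoc ps (L ++ ss) _) (cong (ps ++_) (++-assoc L ss _)) , pu
    Pres-subtree {ls = l ∷ _} (_ ∷ ps) (there c∈) u⊑c with Pres-subtree ps c∈ u⊑c
    ... | ps′ , ss , L , eq , pu = l ++ ps′ , ss , L , trans (cong (l ++_) eq) (sym (++-assoc l ps′ _)) , pu

  Pre-head : ∀ {v l} → Pre T v l → v ∈ₗ l
  Pre-head (pre _ _ _ _ _ _) = here refl

  Pre-∈ : ∀ {v l x} → Pre T v l → x ⊑ v → x ∈ₗ l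
  Pre-∈ pv x⊑v with Pre-subtree pv x⊑v
  ... | ps , _ , _ , refl , px = ∈-++⁺ʳ ps (∈-++⁺ˡ (Pre-head px))

  mutual
    Pre-unique : ∀ {v l} → Pre T v l → Unique l
    Pre-unique {v} (pre _ uniq children _ _ pres) = ¬Any⇒All¬ _ v∉ ∷ Pres-unique uniq children pres
      where
      v∉ : ¬ v ∈ₗ _
      v∉ v∈ with Pres-⊑ pres v∈
      ... | c , c∈ , v⊑c with children c c∈
      ...   | c-child@(_ , c≢v) = c≢v (⊑-antisym (Child⇒⊑ c-child) v⊑c)

    Pres-unique : ∀ {v cs ls} → Unique cs → (∀ c → c ∈ₗ cs → Child T c v) →
                  Pointwise (Pre T) cs ls → Unique (concat ls)
    Pres-unique _ _ [] = []
    Pres-unique (c∉cs ∷ uniq) children (p ∷ ps) =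
      ++⁺ (Pre-unique p) (Pres-unique uniq (λ c c∈ → children c (there c∈)) ps) disjoint
      where
      disjoint : ∀ {x} → ¬ (x ∈ₗ _ × x ∈ₗ _)
      disjoint (x∈l , x∈ls) with Pres-⊑ ps x∈ls
      ... | c′ , c′∈ , x⊑c′ = siblings-disjoint (children _ (here refl)) (children c′ (there c′∈))
                                (All.lookup c∉cs c′∈) (Pre-⊑ p x∈l) x⊑c′

module PreorderTraversal {m : ℕ} (T : RootedTree m) {π : List (Fin m)} (traversal : Preorder T π) where

  open Ancestry T

  π-unique : Unique π
  π-unique = Pre-unique traversal

  π-complete : ∀ i → i ∈ₗ π
  π-complete i = Pre-∈ traversal (reach-root T i)

  π-trichotomy : ∀ i j → i ≡ j ⊎ Before π i j ⊎ Before π j i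
  π-trichotomy i j with i ≟ j
  ... | yes i≡j = inj₁ i≡j
  ... | no i≢j = inj₂ (Before-total (π-complete i) (π-complete j) i≢j)

  ancestor-before : ∀ {i j} → i ⊑ j → i ≢ j → Before π j i
  ancestor-before {j = j} i⊑j i≢j with Pre-subtree traversal (reach-root T j)
  ... | ps , ss , _ , refl , pj@(pre _ _ _ _ _ _) with Pre-∈ pj i⊑j
  ...   | here i≡j = ⊥-elim (i≢j i≡j)
  ...   | there i∈ = Before-++ˡ ps (Before-++ʳ ss (Before-head i∈))

  subtree-contiguous : ∀ {q u r} → q ⊑ u → Before π u r → Before π r q → r ⊑ u
  subtree-contiguous {u = u} q⊑u u<r r<q with Pre-subtree traversal (reach-root T u)
  ... | ps , ss , L , refl , pu = Pre-⊑ pu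
    (Before-segment ps L ss π-unique (Pre-head pu) (Pre-∈ pu q⊑u) u<r r<q)

module Decomposition {n m k : ℕ} {G : Graph n} {T : RootedTree m} (D : TreeDecomp G T k) where

  open Ancestry T

  ∈-X-between : ∀ {p j a v} → p ⊑ j → j ⊑ a → v ∈ X D p → v ∈ X D a → v ∈ X D j
  ∈-X-between {p} {j} {a} p⊑j j⊑a v∈p v∈a with j ≟ a
  ... | yes refl = v∈a
  ... | no j≢a with Walk⇒TPath (proj₂ (⊑⇒Walk (⊑-trans p⊑j j⊑a)))
  ...   | q , path = coherent D p j a q path j∈q _ v∈p v∈a
    where
    j∈q : j ∈ₗ q
    j∈q = proj₁ (Walk-leaves-subtree (proj₁ path) p⊑j (λ a⊑j → j≢a (⊑-antisym j⊑a a⊑j)))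

  module HighestBag (b : Fin n → Fin m) (b-bag : ∀ v → v ∈ X D (b v))
                    (b-top : ∀ v i → ProperAnc T (b v) i → v ∉ X D i) where

    ∈-X⇒⊑-b : ∀ {v i} → v ∈ X D i → i ⊑ b v
    ∈-X⇒⊑-b {v} {i} v∈i with i ⊑? b v
    ... | yes i⊑bv = i⊑bv
    ... | no i⋢bv with Walk⇒TPath (proj₂ (Walk-via-root (b v) i))
    ...   | q , path with Walk-leaves-subtree (proj₁ path) anc-refl i⋢bv
    ...     | _ , parent∈q , parent≢bv = ⊥-elim (b-top v _ (⊑-par , parent≢bv)
              (coherent D (b v) _ i q path parent∈q v (b-bag v) v∈i))

module _ {n : ℕ} (G : Graph n) {ord : List (Fin n)} where

  τE-sym : ∀ {x y} → τE G ord x y → τE G ord y x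
  τE-sym (inj₁ e) = inj₁ (E-sym G e)
  τE-sym (inj₂ (inj₁ (x∉ , y∉ , x≢y))) = inj₂ (inj₁ (y∉ , x∉ , λ y≡x → x≢y (sym y≡x)))
  τE-sym (inj₂ (inj₂ (inj₁ t))) = inj₂ (inj₂ (inj₂ t))
  τE-sym (inj₂ (inj₂ (inj₂ t))) = inj₂ (inj₂ (inj₁ t))

  τE-∈⇒E⊎later : ∀ {x y} → τE G ord x y → x ∈ₗ ord → E G x y ⊎ ∃[ w ] Before ord x w × E G y w
  τE-∈⇒E⊎later (inj₁ e) _ = inj₁ e
  τE-∈⇒E⊎later (inj₂ (inj₁ (x∉ , _))) x∈ = ⊥-elim (x∉ x∈)
  τE-∈⇒E⊎later (inj₂ (inj₂ (inj₁ (x∉ , _)))) x∈ = ⊥-elim (x∉ x∈)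
  τE-∈⇒E⊎later (inj₂ (inj₂ (inj₂ (_ , _ , _ , _ , _ , here refl , e)))) _ = inj₁ (E-sym G e)
  τE-∈⇒E⊎later {x} (inj₂ (inj₂ (inj₂ (_ , xs , _ , eq , w , there w∈ , e)))) _ =
    inj₂ (w , subst (λ l → Before l x w) (sym eq) (Before-++ˡ xs (Before-head w∈)) , e)

module Intersection {n m k : ℕ} (G : Graph n) (T : RootedTree m) (D : TreeDecomp G T k)
    (b : Fin n → Fin m)
    (b-bag : ∀ v → v ∈ X D (b v))
    (b-top : ∀ v i → ProperAnc T (b v) i → v ∉ X D i)
    (θ : Fin n → Fin (suc k))
    (θ-proper : ∀ i u v → u ∈ X D i → v ∈ X D i → θ u ≡ θ v → u ≡ v)
    {π : List (Fin m)} (traversal : Preorder T π)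
    {σ : List (Fin n)} (σ-unique : Unique σ) (σ-complete : ∀ v → v ∈ₗ σ)
    (σ-follows-π : ∀ u v → Before π (b u) (b v) → Before σ u v) where

  open Ancestry T
  open PreorderTraversal T traversal
  open Decomposition D
  open HighestBag b b-bag b-top

  colour-clash : ∀ {u v} → θ u ≡ θ v → u ∈ X D (b v) → u ≡ v
  colour-clash {u} {v} θu≡θv u∈ = θ-proper (b v) u v u∈ (b-bag v) θu≡θv

  Before-σ⇒≢ : ∀ {u v} → Before σ u v → u ≢ v
  Before-σ⇒≢ u<v refl = Before-irrefl σ-unique u<v

  same-colour-below⇒after : ∀ {p x w} → θ w ≡ θ x → w ≢ x → w ∈ X D p → p ⊑ b x → Before σ x w
  same-colour-below⇒after {p} {x} {w} θw≡θx w≢x w∈p p⊑bx with ⊑-comparable (∈-X⇒⊑-b w∈p) p⊑bx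
  ... | inj₂ bx⊑bw = ⊥-elim (w≢x (colour-clash θw≡θx (∈-X-between p⊑bx bx⊑bw w∈p (b-bag w))))
  ... | inj₁ bw⊑bx with b w ≟ b x
  ...   | yes bw≡bx = ⊥-elim (w≢x (colour-clash θw≡θx (subst (λ i → w ∈ X D i) bw≡bx (b-bag w))))
  ...   | no bw≢bx = σ-follows-π x w (ancestor-before bw⊑bx bw≢bx)

  NeighbourAfter NeighbourBefore : Fin n → Fin n → Set
  NeighbourAfter x y = ∃[ w ] θ w ≡ θ x × Before σ x w × E G y w
  NeighbourBefore x y = ∃[ w ] θ w ≡ θ x × Before σ w x × E G y w

  descendant-case : ∀ {x y} → b y ⊑ b x → ¬ NeighbourBefore x y
  descendant-case by⊑bx (w , θw≡θx , w<x , y~w) with edge D y~w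
  ... | p , y∈p , w∈p = Before-asym σ-unique w<x
    (same-colour-below⇒after θw≡θx (Before-σ⇒≢ w<x) w∈p (⊑-trans (∈-X⇒⊑-b y∈p) by⊑bx))

  non-descendant-case : ∀ {x y} → ¬ b y ⊑ b x → Before π (b x) (b y) → ¬ NeighbourAfter y x
  non-descendant-case {x} {y} by⋢bx bx<by (z , θz≡θy , y<z , x~z) with edge D x~z
  ... | q , x∈q , z∈q with ⊑-comparable (∈-X⇒⊑-b x∈q) (∈-X⇒⊑-b z∈q)
  ...   | inj₁ bx⊑bz = Before-asym σ-unique y<z (σ-follows-π z y bz<by)
    where
    bz<by : Before π (b z) (b y)
    bz<by with b x ≟ b z
    ... | yes bx≡bz = subst (λ i → Before π i (b y)) bx≡bz bx<by
    ... | no bx≢bz = Before-trans π-unique (ancestor-before bx⊑bz bx≢bz) bx<by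
  ...   | inj₂ bz⊑bx with π-trichotomy (b y) (b z)
  ...     | inj₁ by≡bz = Before-σ⇒≢ y<z (sym (colour-clash θz≡θy (subst (λ i → z ∈ X D i) (sym by≡bz) (b-bag z))))
  ...     | inj₂ (inj₁ by<bz) = by⋢bx (subtree-contiguous bz⊑bx bx<by by<bz)
  ...     | inj₂ (inj₂ bz<by) = Before-asym σ-unique y<z (σ-follows-π z y bz<by)

  no-crossing : ∀ {x y} → b x ≡ b y ⊎ Before π (b x) (b y) →
                NeighbourBefore x y → NeighbourAfter y x → ⊥
  no-crossing {x} {y} bx≤by before after with b y ⊑? b x | bx≤by
  ... | yes by⊑bx | _ = descendant-case by⊑bx before
  ... | no by⋢bx | inj₁ bx≡by = by⋢bx (subst (b y ⊑_) (sym bx≡by) anc-refl)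
  ... | no by⋢bx | inj₂ bx<by = non-descendant-case by⋢bx bx<by after

  C C⁻ : Fin (suc k) → List (Fin n)
  C i = filter (λ v → θ v ≟ i) σ
  C⁻ i = filter (λ v → θ v ≟ i) (reverse σ)

  later-neighbour : ∀ {x y} → τE G (C (θ x)) x y → E G x y ⊎ NeighbourAfter x y
  later-neighbour {x} t with τE-∈⇒E⊎later G t (∈-filter⁺ (λ v → θ v ≟ θ x) (σ-complete x) refl)
  ... | inj₁ e = inj₁ e
  ... | inj₂ (w , x<w , y~w) =
    inj₂ (w , proj₂ (∈-filter⁻ (λ v → θ v ≟ θ x) {xs = σ} (Before-∈ʳ x<w)) , Before-filter⁻ _ x<w , y~w)

  earlier-neighbour : ∀ {x y} → τE G (C⁻ (θ x)) x y → E G x y ⊎ NeighbourBefore x y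
  earlier-neighbour {x} t with τE-∈⇒E⊎later G t (∈-filter⁺ (λ v → θ v ≟ θ x) (reverse⁺ (σ-complete x)) refl)
  ... | inj₁ e = inj₁ e
  ... | inj₂ (w , x<w , y~w) = inj₂ (w , proj₂ (∈-filter⁻ (λ v → θ v ≟ θ x) {xs = reverse σ} (Before-∈ʳ x<w)) ,
                                     Before-reverse⁻ (Before-filter⁻ _ x<w) , y~w)

  ⋂τ⊆G : ∀ {x y} → (∀ i → τE G (C i) x y × τE G (C⁻ i) x y) → E G x y
  ⋂τ⊆G {x} {y} τ with later-neighbour (proj₁ (τ (θ x))) | earlier-neighbour (proj₂ (τ (θ x)))
                    | later-neighbour (τE-sym G (proj₁ (τ (θ y))))
                    | earlier-neighbour (τE-sym G (proj₂ (τ (θ y))))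
  ... | inj₁ e | _ | _ | _ = e
  ... | _ | inj₁ e | _ | _ = e
  ... | _ | _ | inj₁ e | _ = E-sym G e
  ... | _ | _ | _ | inj₁ e = E-sym G e
  ... | inj₂ x-after | inj₂ x-before | inj₂ y-after | inj₂ y-before with π-trichotomy (b x) (b y)
  ...   | inj₁ bx≡by = ⊥-elim (no-crossing (inj₁ bx≡by) x-before y-after)
  ...   | inj₂ (inj₁ bx<by) = ⊥-elim (no-crossing (inj₂ bx<by) x-before y-after)
  ...   | inj₂ (inj₂ by<bx) = ⊥-elim (no-crossing (inj₂ by<bx) y-before x-after)

lemma6 : ∀ {n m k : ℕ} (G : Graph n) (T : RootedTree m) (D : TreeDecomp G T k)
    (b : Fin n → Fin m)
    → (∀ v → v ∈ X D (b v))
    → (∀ v i → ProperAnc T (b v) i → v ∉ X D i)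
    → (θ : Fin n → Fin (suc k))
    → (∀ i u v → u ∈ X D i → v ∈ X D i → θ u ≡ θ v → u ≡ v)
    → (π : List (Fin m)) → Preorder T π
    → (σ : List (Fin n)) → Unique σ → (∀ v → v ∈ₗ σ)
    → (∀ u v → Before π (b u) (b v) → Before σ u v)
    → ∀ x y → (E G x y ⇔
         (∀ (i : Fin (suc k)) →
            τE G (filter (λ v → θ v ≟ i) σ) x y
          × τE G (filter (λ v → θ v ≟ i) (reverse σ)) x y))
lemma6 G T D b b-bag b-top θ θ-proper π traversal σ σ-unique σ-complete σ-follows-π x y =
  mk⇔ (λ e _ → inj₁ e , inj₁ e)
      (Intersection.⋂τ⊆G G T D b b-bag b-top θ θ-proper traversal σ-unique σ-complete σ-follows-π)
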